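{- Let $P\subset\mathbb{R}^n$ be an antiblocking lattice polytope of dimension $d$. (i) The set $\mathbb{Z}^n\cap P$ is shifted, and so is $\mathbb{Z}^n\cap mP$ for every $m\in\mathbb{N}$. (ii) There is a re-indexing of the coordinates of $\mathbb{R}^n$ such that the translated set $\mathbb{Z}^n\cap\mathrm{int}(P)-(\mathbf{1}_d,\mathbf{0}_{n-d})=\{\mathbf{z}-(\mathbf{1}_d,\mathbf{0}_{n-d}):\mathbf{z}\in\mathbb{Z}^n\cap\mathrm{int}(P)\}$ is shifted, and the same holds for $\mathbb{Z}^n\cap\mathrm{int}(mP)-(\mathbf{1}_d,\mathbf{0}_{n-d})$ for every integer $m\ge1$.
   Context: $\mathbb{N}=\{0,1,2,\dots\}$; the componentwise order on $\mathbb{R}^n_{\ge0}$ is $\mathbf{z}\le\mathbf{z}'$ iff $z_i\le z'_i$ for all $i$. A convex polytope $P$ is antiblocking if $P\subset\mathbb{R}^n_{\ge0}$ and whenever $\mathbf{0}\le\mathbf{z}\le\mathbf{z}'$ with $\mathbf{z}'\in P$, then $\mathbf{z}\in P$. A subset $\mathcal{Z}\subset\mathbb{R}^n$ is shifted if $\mathcal{Z}\subset\mathbb{N}^n$ and whenever $\mathbf{0}\le\mathbf{z}\le\mathbf{z}'$ with $\mathbf{z}\in\mathbb{N}^n$ and $\mathbf{z}'\in\mathcal{Z}$, then $\mathbf{z}\in\mathcal{Z}$. $\mathrm{int}$ denotes relative interior, $mP=\{mp:p\in P\}$, and $(\mathbf{1}_d,\mathbf{0}_{n-d})$ is the vector with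 $d$ ones followed by $n-d$ zeros.
   Formalization: Polytope membership, the antiblocking condition, the relative interior and the dimension of P are defined through rational points, over ℚ^n instead of ℝ^n. -}

module Defs where

open import Data.Nat using (ℕ; zero; suc; _<ᵇ_)
open import Data.Integer as ℤ using (ℤ; +_)
open import Data.Rational using (ℚ; 0ℚ; 1ℚ; _+_; _-_; _*_; _≤_; _<_; ∣_∣; _/_)
open import Data.Fin using (Fin; toℕ)
open import Data.Bool using (if_then_else_)
open import Data.Product using (Σ; _×_; ∃)
open import Relation.Binary.PropositionalEquality using (_≡_)
open import Relation.Nullary using (¬_)
open import Data.Fin.Permutation using (Permutation′; _⟨$⟩ʳ_)

ℚⁿ : ℕ → Set
ℚⁿ n = Fin n → ℚ

ℤⁿ : ℕ → Set
ℤⁿ n = Fin n → ℤ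

toℚⁿ : ∀ {n} → ℤⁿ n → ℚⁿ n
toℚⁿ z i = z i / 1

∑ : ∀ {k} → (Fin k → ℚ) → ℚ
∑ {zero} f = 0ℚ
∑ {suc k} f = f Fin.zero + ∑ (λ j → f (Fin.suc j))

-- A lattice polytope in ℝ^n: the convex hull of finitely many lattice points
-- V 0, …, V (k-1) ∈ ℤ^n.
record LatticePolytope (n : ℕ) : Set where
  constructor polytope
  field
    k : ℕ
    vert : Fin k → ℤⁿ n
open LatticePolytope public

_∈P_ : ∀ {n} → ℚⁿ n → LatticePolytope n → Set
x ∈P P = Σ (Fin (k P) → ℚ) λ λ' →
  (∀ j → 0ℚ ≤ λ' j) × (∑ λ' ≡ 1ℚ) ×
  (∀ i → ∑ (λ j → λ' j * (vert P j i / 1)) ≡ x i)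

_∈Aff_ : ∀ {n} → ℚⁿ n → LatticePolytope n → Set
x ∈Aff P = Σ (Fin (k P) → ℚ) λ c →
  (∑ c ≡ 1ℚ) × (∀ i → ∑ (λ j → c j * (vert P j i / 1)) ≡ x i)

-- mP, the dilate: conv(m V) = m · conv(V)
_·P_ : ∀ {n} → ℕ → LatticePolytope n → LatticePolytope n
m ·P P = polytope (k P) (λ j i → + m ℤ.* vert P j i)

-- relative interior: x ∈ P and some (sup-norm) ε-ball of aff(P) around x lies in P
_∈int_ : ∀ {n} → ℚⁿ n → LatticePolytope n → Set
_∈int_ {n} x P = (x ∈P P) × Σ ℚ λ ε → (0ℚ < ε) ×
  (∀ (y : ℚⁿ n) → y ∈Aff P → (∀ i → ∣ y i - x i ∣ < ε) → y ∈P P)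

Antiblocking : ∀ {n} → LatticePolytope n → Set
Antiblocking {n} P =
  (∀ (x : ℚⁿ n) → x ∈P P → ∀ i → 0ℚ ≤ x i) ×
  (∀ (x x' : ℚⁿ n) → (∀ i → 0ℚ ≤ x i) → (∀ i → x i ≤ x' i) → x' ∈P P → x ∈P P)

AffInd : ∀ {n r} → (Fin r → ℚⁿ n) → Set
AffInd {n} {r} p = ∀ (c : Fin r → ℚ) → ∑ c ≡ 0ℚ →
  (∀ i → ∑ (λ j → c j * p j i) ≡ 0ℚ) → ∀ j → c j ≡ 0ℚ

HasDim : ∀ {n} → LatticePolytope n → ℕ → Set
HasDim {n} P d =
  (Σ (Fin (suc d) → ℚⁿ n) λ p → (∀ j → p j ∈P P) × AffInd p) ×
  (∀ (p : Fin (suc (suc d)) → ℚⁿ n) → (∀ j → p j ∈P P) → ¬ AffInd p)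

Shifted : ∀ {n} → (ℤⁿ n → Set) → Set
Shifted {n} Z =
  (∀ z → Z z → ∀ i → + 0 ℤ.≤ z i) ×
  (∀ (z z' : ℤⁿ n) → (∀ i → + 0 ℤ.≤ z i) → (∀ i → z i ℤ.≤ z' i) → Z z' → Z z)

LatticePts : ∀ {n} → LatticePolytope n → ℤⁿ n → Set
LatticePts P z = toℚⁿ z ∈P P

IntLatticePts : ∀ {n} → LatticePolytope n → ℤⁿ n → Set
IntLatticePts P z = toℚⁿ z ∈int P

𝟙 : ∀ {n} → ℕ → ℤⁿ n
𝟙 d i = if toℕ i <ᵇ d then + 1 else + 0

-- { z∘σ - (1_d,0_{n-d}) : z ∈ ℤ^n ∩ int(P) } after re-indexing coordinates by σ
-- (new coordinate i is old coordinate σ i)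
ShiftedInterior : ∀ {n} → Permutation′ n → ℕ → LatticePolytope n → ℤⁿ n → Set
ShiftedInterior σ d P w =
  ∃ λ z → IntLatticePts P z × (∀ i → w i ≡ z (σ ⟨$⟩ʳ i) ℤ.- 𝟙 d i)

{-# OPTIONS --safe #-}
-- Let S be the support of P, the coordinates on which some vertex is nonzero. Being
-- antiblocking, P contains 0 and the unit vectors e_j (j ∈ S), while aff(P) lies in the
-- coordinate subspace ℚ^S; hence dim P = |S|, and a permutation moves S onto the first d
-- coordinates. Part (i) is the downward closure of P, and of mP, which is again antiblocking.
-- For (ii), a lattice point z of int(P) has z_j ≥ 1 on S, because z − μ e_j stays in P for
-- small μ > 0. Conversely, a nonnegative lattice point z ≤ z′ ∈ int(P) with z ≥ 1 on S is
-- interior: a ball of radius ≤ 1 around z in aff(P) is nonnegative, and translating it by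
-- z′ − z lands in the ball around z′, hence in P. So subtracting (1_d, 0) identifies
-- ℤⁿ ∩ int(P) with a shifted set.

module Submission where

open import Defs
open import Data.Nat using (ℕ; _≥_)
open import Data.Product using (Σ; _×_)
open import Data.Fin.Permutation using (Permutation′)

open import Algebra.Bundles using (CommutativeRing)
open import Data.Bool using (true; false; if_then_else_)
open import Data.Bool.Properties using (T-≡)
open import Data.Fin using (Fin; zero; suc; toℕ; fromℕ<; inject≤; punchIn; punchOut; _≟_)
import Data.Fin.Properties as FinP
open import Data.Fin.Permutation using (_⟨$⟩ʳ_; _⟨$⟩ˡ_; inverseˡ; inverseʳ; insert; id)
open import Data.Integer as ℤ using (ℤ; +_)
import Data.Integer.Properties as ℤP
open import Data.Nat as ℕ using (zero; suc; z≤n; s≤s; z<s; s<s; s<s⁻¹; _<ᵇ_)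
import Data.Nat.Properties as ℕP
open import Data.Product using (∃; _,_; proj₁; proj₂)
open import Data.Rational as ℚ using (ℚ; 0ℚ; 1ℚ; _+_; _-_; _*_; -_; _≤_; _<_; ∣_∣; _/_; _⊓_; 1/_; toℚᵘ)
import Data.Rational.Properties as ℚP
open import Data.Rational.Solver using (module +-*-Solver)
open import Data.Rational.Unnormalised using (mkℚᵘ; *≤*; *<*) renaming (_≃_ to _≃ᵘ_)
import Data.Rational.Unnormalised.Properties as ℚᵘP
open import Data.Sum using (_⊎_; inj₁; inj₂; [_,_])
open import Function using (_∘_; case_of_)
open import Function.Bundles using (_⇔_; mk⇔; Equivalence; Injection)
open import Function.Definitions using (Injective)
import Function.Properties.Equivalence as ⇔
open import Function.Properties.Inverse using (↔⇒↣)
open import Relation.Binary.PropositionalEquality using (_≡_; _≢_; refl; sym; trans; cong; cong₂; subst; subst₂; module ≡-Reasoning)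
open import Relation.Nullary using (¬_; yes; no; does; contradiction; ¬?)
open import Relation.Nullary.Decidable using (dec-true; dec-false; decidable-stable)
open import Relation.Unary using (Pred; Decidable)
open import Algebra.Properties.Semiring.Sum (CommutativeRing.semiring ℚP.+-*-commutativeRing)
  using (sum; sum-cong-≗; ∑-distrib-+; *-distribˡ-sum; sum-replicate-zero)

open +-*-Solver

-∣p∣≤p : ∀ p → - ∣ p ∣ ≤ p
-∣p∣≤p p with ℚP.∣p∣≡p∨∣p∣≡-p p
... | inj₁ ∣p∣≡p = ℚP.≤-trans (ℚP.neg-antimono-≤ (ℚP.0≤∣p∣ p)) (ℚP.∣p∣≡p⇒0≤p ∣p∣≡p)
... | inj₂ ∣p∣≡-p = ℚP.≤-reflexive (trans (cong -_ ∣p∣≡-p) (solve 1 (λ p → :- (:- p) := p) refl p))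

⊓-pos : ∀ {p q} → 0ℚ < p → 0ℚ < q → 0ℚ < p ⊓ q
⊓-pos {p} {q} p>0 q>0 with ℚP.≤-total p q
... | inj₁ p≤q = subst (0ℚ <_) (sym (ℚP.p≤q⇒p⊓q≡p p≤q)) p>0
... | inj₂ q≤p = subst (0ℚ <_) (sym (ℚP.p≥q⇒p⊓q≡q q≤p)) q>0

i+j-j≡i : ∀ i j → (i ℤ.+ j) ℤ.- j ≡ i
i+j-j≡i i j = trans (ℤP.+-assoc i j (ℤ.- j)) (trans (cong (ℤ._+_ i) (ℤP.+-inverseʳ j)) (ℤP.+-identityʳ i))

i-j+j≡i : ∀ i j → (i ℤ.- j) ℤ.+ j ≡ i
i-j+j≡i i j = trans (ℤP.+-assoc i (ℤ.- j) j) (trans (cong (ℤ._+_ i) (ℤP.+-inverseˡ j)) (ℤP.+-identityʳ i))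

ι : ℤ → ℚ
ι z = z / 1

toℚᵘ-ι : ∀ z → toℚᵘ (ι z) ≃ᵘ mkℚᵘ z 0
toℚᵘ-ι z = ℚP.toℚᵘ-fromℚᵘ (mkℚᵘ z 0)

ι-mono-≤ : ∀ {a b} → a ℤ.≤ b → ι a ≤ ι b
ι-mono-≤ {a} {b} a≤b = ℚP.toℚᵘ-cancel-≤
  (ℚᵘP.≤-respˡ-≃ (ℚᵘP.≃-sym (toℚᵘ-ι a)) (ℚᵘP.≤-respʳ-≃ (ℚᵘP.≃-sym (toℚᵘ-ι b))
    (*≤* (subst₂ ℤ._≤_ (sym (ℤP.*-identityʳ a)) (sym (ℤP.*-identityʳ b)) a≤b))))

ι-cancel-≤ : ∀ {a b} → ι a ≤ ι b → a ℤ.≤ b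
ι-cancel-≤ {a} {b} ιa≤ιb
  with ℚᵘP.≤-respˡ-≃ (toℚᵘ-ι a) (ℚᵘP.≤-respʳ-≃ (toℚᵘ-ι b) (ℚP.toℚᵘ-mono-≤ ιa≤ιb))
... | *≤* a≤b = subst₂ ℤ._≤_ (ℤP.*-identityʳ a) (ℤP.*-identityʳ b) a≤b

ι-cancel-< : ∀ {a b} → ι a < ι b → a ℤ.< b
ι-cancel-< {a} {b} ιa<ιb
  with ℚᵘP.<-respˡ-≃ (toℚᵘ-ι a) (ℚᵘP.<-respʳ-≃ (toℚᵘ-ι b) (ℚP.toℚᵘ-mono-< ιa<ιb))
... | *<* a<b = subst₂ ℤ._<_ (ℤP.*-identityʳ a) (ℤP.*-identityʳ b) a<b

ι-homo-* : ∀ a b → ι (a ℤ.* b) ≡ ι a * ι b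
ι-homo-* a b = ℚP.toℚᵘ-injective (ℚᵘP.≃-trans (toℚᵘ-ι (a ℤ.* b))
  (ℚᵘP.≃-sym (ℚᵘP.≃-trans (ℚP.toℚᵘ-homo-* (ι a) (ι b)) (ℚᵘP.*-cong (toℚᵘ-ι a) (toℚᵘ-ι b)))))

ι-nonneg : ∀ (m : ℕ) → 0ℚ ≤ ι (+ m)
ι-nonneg m = ι-mono-≤ {+ 0} {+ m} (ℤ.+≤+ z≤n)

∑≡sum : ∀ {k} (f : Fin k → ℚ) → ∑ f ≡ sum f
∑≡sum {zero} f = refl
∑≡sum {suc k} f = cong (_+_ (f zero)) (∑≡sum (f ∘ suc))

∑-cong : ∀ {k} {f g : Fin k → ℚ} → (∀ j → f j ≡ g j) → ∑ f ≡ ∑ g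
∑-cong {f = f} {g} f≗g rewrite ∑≡sum f | ∑≡sum g = sum-cong-≗ f≗g

∑-zero : ∀ k → ∑ {k} (λ _ → 0ℚ) ≡ 0ℚ
∑-zero k rewrite ∑≡sum {k} (λ _ → 0ℚ) = sum-replicate-zero k

∑-+ : ∀ {k} (f g : Fin k → ℚ) → ∑ (λ j → f j + g j) ≡ ∑ f + ∑ g
∑-+ f g rewrite ∑≡sum (λ j → f j + g j) | ∑≡sum f | ∑≡sum g = ∑-distrib-+ f g

∑-*ˡ : ∀ {k} c (f : Fin k → ℚ) → ∑ (λ j → c * f j) ≡ c * ∑ f
∑-*ˡ c f rewrite ∑≡sum (λ j → c * f j) | ∑≡sum f = sym (*-distribˡ-sum c f)

∑-- : ∀ {k} (f g : Fin k → ℚ) → ∑ (λ j → f j - g j) ≡ ∑ f - ∑ g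
∑-- f g = begin
  ∑ (λ j → f j - g j)                 ≡⟨ ∑-cong (λ j → cong (_+_ (f j)) (neg≡-1* (g j))) ⟩
  ∑ (λ j → f j + - 1ℚ * g j)         ≡⟨ ∑-+ f _ ⟩
  ∑ f + ∑ (λ j → - 1ℚ * g j)          ≡⟨ cong (_+_ (∑ f)) (∑-*ˡ (- 1ℚ) g) ⟩
  ∑ f + - 1ℚ * ∑ g                    ≡⟨ cong (_+_ (∑ f)) (neg≡-1* (∑ g)) ⟨
  ∑ f - ∑ g                           ∎
  where
  open ≡-Reasoning
  neg≡-1* : ∀ p → - p ≡ - 1ℚ * p
  neg≡-1* p = solve 1 (λ p → :- p := (:- con 1ℚ) :* p) refl p

∑-translate : ∀ {k} (c a b : Fin k → ℚ) s →
              ∑ (λ t → c t + s * (a t - b t)) ≡ ∑ c + s * (∑ a - ∑ b)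
∑-translate c a b s = begin
  ∑ (λ t → c t + s * (a t - b t))     ≡⟨ ∑-+ c _ ⟩
  ∑ c + ∑ (λ t → s * (a t - b t))     ≡⟨ cong (_+_ (∑ c)) (∑-*ˡ s (λ t → a t - b t)) ⟩
  ∑ c + s * ∑ (λ t → a t - b t)       ≡⟨ cong (λ u → ∑ c + s * u) (∑-- a b) ⟩
  ∑ c + s * (∑ a - ∑ b)               ∎
  where open ≡-Reasoning

δ : ∀ {k} → Fin k → Fin k → ℚ
δ i j = if does (i ≟ j) then 1ℚ else 0ℚ

δ-diag : ∀ {k} (i : Fin k) → δ i i ≡ 1ℚ
δ-diag i rewrite dec-true (i ≟ i) refl = refl

δ-offdiag : ∀ {k} {i j : Fin k} → i ≢ j → δ i j ≡ 0ℚ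
δ-offdiag {i = i} {j} i≢j rewrite dec-false (i ≟ j) i≢j = refl

δ-nonneg : ∀ {k} (i j : Fin k) → 0ℚ ≤ δ i j
δ-nonneg i j with does (i ≟ j)
... | true = ℚP.<⇒≤ (ℚP.positive⁻¹ 1ℚ)
... | false = ℚP.≤-refl

δ-injective : ∀ {k l} {f : Fin k → Fin l} → Injective _≡_ _≡_ f → ∀ i j → δ (f i) (f j) ≡ δ i j
δ-injective {f = f} f-inj i j with i ≟ j
... | yes refl = δ-diag (f i)
... | no i≢j = δ-offdiag (i≢j ∘ f-inj)

∣p*δ∣≤∣p∣ : ∀ {k} p (i j : Fin k) → ∣ p * δ i j ∣ ≤ ∣ p ∣
∣p*δ∣≤∣p∣ p i j with does (i ≟ j)
... | true = ℚP.≤-reflexive (cong ∣_∣ (ℚP.*-identityʳ p))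
... | false = subst (_≤ ∣ p ∣) (cong ∣_∣ (sym (ℚP.*-zeroʳ p))) (ℚP.0≤∣p∣ p)

∑-δ : ∀ {k} (f : Fin k → ℚ) j₀ → ∑ (λ j → f j * δ j j₀) ≡ f j₀
∑-δ {suc k} f zero = begin
  f zero * 1ℚ + ∑ (λ j → f (suc j) * 0ℚ)  ≡⟨ cong₂ _+_ (ℚP.*-identityʳ (f zero)) (∑-cong (λ j → ℚP.*-zeroʳ (f (suc j)))) ⟩
  f zero + ∑ {k} (λ _ → 0ℚ)               ≡⟨ cong (_+_ (f zero)) (∑-zero k) ⟩
  f zero + 0ℚ                             ≡⟨ ℚP.+-identityʳ (f zero) ⟩
  f zero                                  ∎
  where open ≡-Reasoning
∑-δ {suc k} f (suc j₀) = begin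
  f zero * 0ℚ + ∑ (λ j → f (suc j) * δ j j₀)  ≡⟨ cong₂ _+_ (ℚP.*-zeroʳ (f zero)) (∑-δ (f ∘ suc) j₀) ⟩
  0ℚ + f (suc j₀)                             ≡⟨ ℚP.+-identityˡ (f (suc j₀)) ⟩
  f (suc j₀)                                  ∎
  where open ≡-Reasoning

-- Homogeneous linear systems

HasNontrivialKernel : ∀ {m N} → (Fin m → Fin N → ℚ) → Set
HasNontrivialKernel {N = N} A =
  Σ (Fin N → ℚ) λ c → (∃ λ j → c j ≢ 0ℚ) × (∀ r → ∑ (λ j → A r j * c j) ≡ 0ℚ)

zero-column⇒kernel : ∀ {m N} (A : Fin m → Fin (suc N) → ℚ) →
                     (∀ r → A r zero ≡ 0ℚ) → HasNontrivialKernel A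
zero-column⇒kernel A column≡0 =
  (λ j → δ j zero) , (zero , ℚP.1≢0) ,
  λ r → trans (∑-δ (A r) zero) (column≡0 r)

module _ {m N} (A : Fin (suc m) → Fin (suc N) → ℚ) (r₀ : Fin (suc m)) (pivot≢0 : A r₀ zero ≢ 0ℚ) where

  private
    a = A r₀ zero
    instance
      pivot-nonZero : ℚ.NonZero a
      pivot-nonZero = ℚ.≢-nonZero pivot≢0

  eliminate : Fin m → Fin N → ℚ
  eliminate r j = A (punchIn r₀ r) (suc j) - (A (punchIn r₀ r) zero * 1/ a) * A r₀ (suc j)

  kernel-lift : HasNontrivialKernel eliminate → HasNontrivialKernel A
  kernel-lift (c , (j₁ , c≢0) , rows) = c⁺ , (suc j₁ , c≢0) , rows⁺
    where
    open ≡-Reasoning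
    T = ∑ (λ j → A r₀ (suc j) * c j)

    c⁺ : Fin (suc N) → ℚ
    c⁺ zero = - (T * 1/ a)
    c⁺ (suc j) = c j

    pivot-row : a * c⁺ zero + T ≡ 0ℚ
    pivot-row = begin
      a * - (T * 1/ a) + T  ≡⟨ solve 3 (λ a a⁻¹ T → a :* (:- (T :* a⁻¹)) :+ T := T :- T :* (a :* a⁻¹)) refl a (1/ a) T ⟩
      T - T * (a * 1/ a)    ≡⟨ cong (λ u → T - T * u) (ℚP.*-inverseʳ a) ⟩
      T - T * 1ℚ            ≡⟨ cong (λ u → T - u) (ℚP.*-identityʳ T) ⟩
      T - T                 ≡⟨ ℚP.+-inverseʳ T ⟩
      0ℚ                    ∎

    other-row : ∀ r → A (punchIn r₀ r) zero * c⁺ zero + ∑ (λ j → A (punchIn r₀ r) (suc j) * c j) ≡ 0ℚ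
    other-row r = begin
      b * - (T * 1/ a) + ∑ x                  ≡⟨ solve 4 (λ b a⁻¹ T R → b :* (:- (T :* a⁻¹)) :+ R := R :- (b :* a⁻¹) :* T) refl b (1/ a) T (∑ x) ⟩
      ∑ x - (b * 1/ a) * T                    ≡⟨ cong (λ u → ∑ x - u) (∑-*ˡ (b * 1/ a) y) ⟨
      ∑ x - ∑ (λ j → (b * 1/ a) * y j)        ≡⟨ ∑-- x (λ j → (b * 1/ a) * y j) ⟨
      ∑ (λ j → x j - (b * 1/ a) * y j)        ≡⟨ ∑-cong (λ j → solve 4 (λ u k v z → u :* z :- k :* (v :* z) := (u :- k :* v) :* z) refl (A (punchIn r₀ r) (suc j)) (b * 1/ a) (A r₀ (suc j)) (c j)) ⟩
      ∑ (λ j → eliminate r j * c j)           ≡⟨ rows r ⟩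
      0ℚ                                      ∎
      where
      b = A (punchIn r₀ r) zero
      x y : Fin N → ℚ
      x j = A (punchIn r₀ r) (suc j) * c j
      y j = A r₀ (suc j) * c j

    rows⁺ : ∀ r → ∑ (λ j → A r j * c⁺ j) ≡ 0ℚ
    rows⁺ r with r₀ ≟ r
    ... | yes refl = pivot-row
    ... | no r₀≢r = subst (λ r → ∑ (λ j → A r j * c⁺ j) ≡ 0ℚ) (FinP.punchIn-punchOut r₀≢r) (other-row (punchOut r₀≢r))

underdetermined⇒kernel : ∀ {m N} → m ℕ.< N → (A : Fin m → Fin N → ℚ) → HasNontrivialKernel A
underdetermined⇒kernel {zero} {suc N} _ A = zero-column⇒kernel A (λ ())
underdetermined⇒kernel {suc m} {suc N} (s<s m<N) A with FinP.all? (λ r → A r zero ℚP.≟ 0ℚ)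
... | yes column≡0 = zero-column⇒kernel A column≡0
... | no column≢0 with FinP.¬∀⟶∃¬ _ _ (λ r → A r zero ℚP.≟ 0ℚ) column≢0
...   | r₀ , pivot≢0 = kernel-lift A r₀ pivot≢0 (underdetermined⇒kernel m<N (eliminate A r₀ pivot≢0))

-- Moving the coordinates that satisfy a predicate to the front

punchIn-<-pivot : ∀ {n} (q : Fin (suc n)) (k : Fin n) → toℕ k ℕ.< toℕ q ⇔ toℕ (punchIn q k) ℕ.< toℕ q
punchIn-<-pivot zero k = mk⇔ (λ ()) (λ ())
punchIn-<-pivot (suc q) zero = ⇔.refl
punchIn-<-pivot (suc q) (suc k) = mk⇔ (s<s ∘ to ∘ s<s⁻¹) (s<s ∘ from ∘ s<s⁻¹)
  where open Equivalence (punchIn-<-pivot q k)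

sort-to-front : ∀ {p n} {P : Pred (Fin n) p} → Decidable P →
                ∃ λ s → s ℕ.≤ n × Σ (Permutation′ n) λ σ → ∀ i → P (σ ⟨$⟩ʳ i) ⇔ toℕ i ℕ.< s
sort-to-front {n = zero} P? = 0 , z≤n , id , λ ()
sort-to-front {n = suc n} {P} P? with P? zero | sort-to-front (P? ∘ suc)
... | yes p₀ | s , s≤n , π , sorted = suc s , s≤s s≤n , insert zero zero π , sorted⁺
  where
  sorted⁺ : ∀ i → P (insert zero zero π ⟨$⟩ʳ i) ⇔ toℕ i ℕ.< suc s
  sorted⁺ zero = mk⇔ (λ _ → z<s) (λ _ → p₀)
  sorted⁺ (suc k) = ⇔.trans (sorted k) (mk⇔ s<s s<s⁻¹)
-- Coordinate 0 fails P, so it is inserted at position s, right after the block where P holds.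
... | no ¬p₀ | s , s≤n , π , sorted = s , ℕP.m≤n⇒m≤1+n s≤n , insert q zero π , sorted⁺
  where
  q : Fin (suc n)
  q = fromℕ< (s<s s≤n)

  sorted⁺ : ∀ i → P (insert q zero π ⟨$⟩ʳ i) ⇔ toℕ i ℕ.< s
  sorted⁺ i with q ≟ i
  ... | yes refl = mk⇔ (λ p₀ → contradiction p₀ ¬p₀) (λ q<s → contradiction q<s (ℕP.<-irrefl (FinP.toℕ-fromℕ< _)))
  ... | no q≢i = ⇔.trans (sorted l)
    (subst (λ j → toℕ l ℕ.< s ⇔ toℕ j ℕ.< s) (FinP.punchIn-punchOut q≢i)
      (subst (λ t → toℕ l ℕ.< t ⇔ toℕ (punchIn q l) ℕ.< t) (FinP.toℕ-fromℕ< _) (punchIn-<-pivot q l)))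
    where
    l = punchOut q≢i

origin : ∀ {n} → ℚⁿ n
origin _ = 0ℚ

basis : ∀ {n} → Fin n → ℚⁿ n
basis j i = δ j i

Support : ∀ {n} → LatticePolytope n → Fin n → Set
Support Q j = ∃ λ t → vert Q t j ≢ + 0

module _ {n} (Q : LatticePolytope n) where

  vertex : Fin (k Q) → ℚⁿ n
  vertex t i = ι (vert Q t i)

  vertex∈P : ∀ t → vertex t ∈P Q
  vertex∈P t = (λ t′ → δ t′ t) , (λ t′ → δ-nonneg t′ t) , weights-sum , coordinates
    where
    weights-sum : ∑ (λ t′ → δ t′ t) ≡ 1ℚ
    weights-sum = trans (∑-cong (λ t′ → sym (ℚP.*-identityˡ (δ t′ t)))) (∑-δ (λ _ → 1ℚ) t)
    coordinates : ∀ i → ∑ (λ t′ → δ t′ t * vertex t′ i) ≡ vertex t i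
    coordinates i = trans (∑-cong (λ t′ → ℚP.*-comm (δ t′ t) (vertex t′ i))) (∑-δ (λ t′ → vertex t′ i) t)

  ∈P⇒∈Aff : ∀ {x} → x ∈P Q → x ∈Aff Q
  ∈P⇒∈Aff (w , _ , Σw , w↦x) = w , Σw , w↦x

  ∈Aff-translate : ∀ {y q r} → y ∈Aff Q → q ∈Aff Q → r ∈Aff Q → ∀ s →
                   (λ i → y i + s * (q i - r i)) ∈Aff Q
  ∈Aff-translate {y} {q} {r} (c , Σc , c↦y) (a , Σa , a↦q) (b , Σb , b↦r) s =
    (λ t → c t + s * (a t - b t)) , weights-sum , coordinates
    where
    open ≡-Reasoning
    weights-sum : ∑ (λ t → c t + s * (a t - b t)) ≡ 1ℚ
    weights-sum = begin
      ∑ (λ t → c t + s * (a t - b t))  ≡⟨ ∑-translate c a b s ⟩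
      ∑ c + s * (∑ a - ∑ b)            ≡⟨ cong₂ (λ u v → u + s * v) Σc (cong₂ _-_ Σa Σb) ⟩
      1ℚ + s * (1ℚ - 1ℚ)               ≡⟨ solve 1 (λ s → con 1ℚ :+ s :* (con 1ℚ :- con 1ℚ) := con 1ℚ) refl s ⟩
      1ℚ                               ∎
    coordinates : ∀ i → ∑ (λ t → (c t + s * (a t - b t)) * vertex t i) ≡ y i + s * (q i - r i)
    coordinates i = begin
      ∑ (λ t → (c t + s * (a t - b t)) * vertex t i)
        ≡⟨ ∑-cong (λ t → solve 5 (λ c s a b v → (c :+ s :* (a :- b)) :* v := c :* v :+ s :* (a :* v :- b :* v)) refl (c t) s (a t) (b t) (vertex t i)) ⟩
      ∑ (λ t → c t * vertex t i + s * (a t * vertex t i - b t * vertex t i))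
        ≡⟨ ∑-translate (λ t → c t * vertex t i) (λ t → a t * vertex t i) (λ t → b t * vertex t i) s ⟩
      ∑ (λ t → c t * vertex t i) + s * (∑ (λ t → a t * vertex t i) - ∑ (λ t → b t * vertex t i))
        ≡⟨ cong₂ (λ u v → u + s * v) (c↦y i) (cong₂ _-_ (a↦q i) (b↦r i)) ⟩
      y i + s * (q i - r i)  ∎

  ∈Aff-outside-support : ∀ {y j} → ¬ Support Q j → y ∈Aff Q → y j ≡ 0ℚ
  ∈Aff-outside-support {y} {j} j∉S (c , _ , c↦y) = begin
    y j                               ≡⟨ c↦y j ⟨
    ∑ (λ t → c t * vertex t j)        ≡⟨ ∑-cong (λ t → trans (cong (λ v → c t * ι v) (vert≡0 t)) (ℚP.*-zeroʳ (c t))) ⟩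
    ∑ {k Q} (λ _ → 0ℚ)                ≡⟨ ∑-zero (k Q) ⟩
    0ℚ                                ∎
    where
    open ≡-Reasoning
    vert≡0 : ∀ t → vert Q t j ≡ + 0
    vert≡0 t = decidable-stable (vert Q t j ℤ.≟ + 0) (λ v≢0 → j∉S (t , v≢0))

  support? : Decidable (Support Q)
  support? j = FinP.any? (λ t → ¬? (vert Q t j ℤ.≟ + 0))

module _ {n} (Q : LatticePolytope n) (ab : Antiblocking Q) where

  private
    nonneg = proj₁ ab
    downward = proj₂ ab

  origin∈P : ∀ {x} → x ∈P Q → origin ∈P Q
  origin∈P {x} x∈Q = downward origin x (λ _ → ℚP.≤-refl) (nonneg x x∈Q) x∈Q

  vert-nonneg : ∀ t i → + 0 ℤ.≤ vert Q t i
  vert-nonneg t i = ι-cancel-≤ (nonneg (vertex Q t) (vertex∈P Q t) i)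

  basis∈P : ∀ {j} → Support Q j → basis j ∈P Q
  basis∈P {j} (t , v≢0) = downward (basis j) (vertex Q t) (δ-nonneg j) below (vertex∈P Q t)
    where
    below : ∀ i → δ j i ≤ vertex Q t i
    below i with j ≟ i
    ... | yes refl = ι-mono-≤ (ℤP.i<j⇒suc[i]≤j (ℤP.≤∧≢⇒< (vert-nonneg t j) (v≢0 ∘ sym)))
    ... | no _ = ι-mono-≤ (vert-nonneg t i)

  ∈int⇒positive : ∀ {x j} → x ∈int Q → Support Q j → 0ℚ < x j
  ∈int⇒positive {x} {j} (x∈Q , ε , ε>0 , ball) j∈S with ℚP.<-dense ε>0
  ... | μ , μ>0 , μ<ε = ℚP.<-≤-trans μ>0 μ≤xⱼ
    where
    y : ℚⁿ n
    y i = x i + (- μ) * (basis j i - origin i)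

    y∈Aff : y ∈Aff Q
    y∈Aff = ∈Aff-translate Q (∈P⇒∈Aff Q x∈Q) (∈P⇒∈Aff Q (basis∈P j∈S)) (∈P⇒∈Aff Q (origin∈P x∈Q)) (- μ)

    y-x : ∀ i → y i - x i ≡ - μ * δ j i
    y-x i = trans (cong (λ d → (x i + - μ * d) - x i) (ℚP.+-identityʳ (δ j i)))
      (solve 3 (λ x s d → (x :+ s :* d) :- x := s :* d) refl (x i) (- μ) (δ j i))

    near : ∀ i → ∣ y i - x i ∣ < ε
    near i = subst (λ u → ∣ u ∣ < ε) (sym (y-x i)) (ℚP.≤-<-trans (∣p*δ∣≤∣p∣ (- μ) j i) ∣-μ∣<ε)
      where
      ∣-μ∣<ε : ∣ - μ ∣ < ε
      ∣-μ∣<ε = subst (_< ε) (sym (trans (ℚP.∣-p∣≡∣p∣ μ) (ℚP.0≤p⇒∣p∣≡p (ℚP.<⇒≤ μ>0)))) μ<ε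

    yⱼ+μ≡xⱼ : y j + μ ≡ x j
    yⱼ+μ≡xⱼ = trans (cong (λ d → (x j + - μ * d) + μ) (trans (ℚP.+-identityʳ (δ j j)) (δ-diag j)))
      (trans (cong (λ u → (x j + u) + μ) (ℚP.*-identityʳ (- μ))) (solve 2 (λ x μ → (x :+ (:- μ)) :+ μ := x) refl (x j) μ))

    μ≤xⱼ : μ ≤ x j
    μ≤xⱼ = subst₂ _≤_ (ℚP.+-identityˡ μ) yⱼ+μ≡xⱼ (ℚP.+-monoˡ-≤ μ (nonneg y (ball y y∈Aff near) j))

  ∈int-downward : ∀ {z z′} → z′ ∈int Q → (∀ i → 0ℚ ≤ z i) → (∀ i → z i ≤ z′ i) →
                  (∀ j → Support Q j → 1ℚ ≤ z j) → z ∈int Q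
  ∈int-downward {z} {z′} (z′∈Q , ε , ε>0 , ball) z≥0 z≤z′ z≥1 =
    z∈Q , ε ⊓ 1ℚ , ⊓-pos ε>0 (ℚP.positive⁻¹ 1ℚ) , ball′
    where
    z∈Q = downward z z′ z≥0 z≤z′ z′∈Q

    ball′ : ∀ y → y ∈Aff Q → (∀ i → ∣ y i - z i ∣ < ε ⊓ 1ℚ) → y ∈P Q
    ball′ y y∈Aff near = downward y y′ y≥0 y≤y′ y′∈Q
      where
      y′ : ℚⁿ n
      y′ i = y i + 1ℚ * (z′ i - z i)

      y′≡y-z+z′ : ∀ i → y′ i ≡ (y i - z i) + z′ i
      y′≡y-z+z′ i = trans (cong (_+_ (y i)) (ℚP.*-identityˡ (z′ i - z i)))
        (solve 3 (λ y z z′ → y :+ (z′ :- z) := (y :- z) :+ z′) refl (y i) (z i) (z′ i))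

      y′-z′ : ∀ i → y′ i - z′ i ≡ y i - z i
      y′-z′ i = trans (cong (_- z′ i) (y′≡y-z+z′ i))
        (solve 3 (λ y z z′ → ((y :- z) :+ z′) :- z′ := y :- z) refl (y i) (z i) (z′ i))

      y′∈Q : y′ ∈P Q
      y′∈Q = ball y′ (∈Aff-translate Q y∈Aff (∈P⇒∈Aff Q z′∈Q) (∈P⇒∈Aff Q z∈Q) 1ℚ)
        (λ i → subst (λ u → ∣ u ∣ < ε) (sym (y′-z′ i)) (ℚP.<-≤-trans (near i) (ℚP.p⊓q≤p ε 1ℚ)))

      y≤y′ : ∀ i → y i ≤ y′ i
      y≤y′ i = subst₂ _≤_
        (solve 2 (λ y z → (y :- z) :+ z := y) refl (y i) (z i)) (sym (y′≡y-z+z′ i))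
        (ℚP.+-monoʳ-≤ (y i - z i) (z≤z′ i))

      y≥0 : ∀ j → 0ℚ ≤ y j
      y≥0 j with support? Q j
      ... | no j∉S = ℚP.≤-reflexive (sym (∈Aff-outside-support Q j∉S y∈Aff))
      ... | yes j∈S = begin
        0ℚ                       ≡⟨ ℚP.+-inverseʳ 1ℚ ⟨
        1ℚ - 1ℚ                  ≤⟨ ℚP.+-mono-≤ (z≥1 j j∈S) (ℚP.neg-antimono-≤ ∣yⱼ-zⱼ∣≤1) ⟩
        z j - ∣ y j - z j ∣      ≤⟨ ℚP.+-monoʳ-≤ (z j) (-∣p∣≤p (y j - z j)) ⟩
        z j + (y j - z j)        ≡⟨ solve 2 (λ z y → z :+ (y :- z) := y) refl (z j) (y j) ⟩
        y j                      ∎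
        where
        open ℚP.≤-Reasoning
        ∣yⱼ-zⱼ∣≤1 : ∣ y j - z j ∣ ≤ 1ℚ
        ∣yⱼ-zⱼ∣≤1 = ℚP.<⇒≤ (ℚP.<-≤-trans (near j) (ℚP.p⊓q≤q ε 1ℚ))

module _ {n} (Q : LatticePolytope n) (m : ℕ) where

  ∑-dilate : ∀ (w : Fin (k Q) → ℚ) i →
             ∑ (λ t → w t * vertex (m ·P Q) t i) ≡ ι (+ m) * ∑ (λ t → w t * vertex Q t i)
  ∑-dilate w i = trans
    (∑-cong (λ t → trans (cong (w t *_) (ι-homo-* (+ m) (vert Q t i)))
      (solve 3 (λ w M v → w :* (M :* v) := M :* (w :* v)) refl (w t) (ι (+ m)) (vertex Q t i))))
    (∑-*ˡ (ι (+ m)) (λ t → w t * vertex Q t i))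

  ∈·P⁻ : ∀ {x} → x ∈P (m ·P Q) → ∃ λ y → y ∈P Q × (∀ i → x i ≡ ι (+ m) * y i)
  ∈·P⁻ (w , w≥0 , Σw , w↦x) =
    (λ i → ∑ (λ t → w t * vertex Q t i)) , (w , w≥0 , Σw , λ _ → refl) ,
    λ i → trans (sym (w↦x i)) (∑-dilate w i)

  ∈·P⁺ : ∀ {x y} → y ∈P Q → (∀ i → x i ≡ ι (+ m) * y i) → x ∈P (m ·P Q)
  ∈·P⁺ (w , w≥0 , Σw , w↦y) x≡my =
    w , w≥0 , Σw , λ i → trans (∑-dilate w i) (trans (cong (ι (+ m) *_) (w↦y i)) (sym (x≡my i)))

  Support-·P : ∀ {j} → Support (suc m ·P Q) j ⇔ Support Q j
  Support-·P = mk⇔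
    (λ (t , mv≢0) → t , λ v≡0 → mv≢0 (trans (cong (ℤ._*_ (+ suc m)) v≡0) (ℤP.*-zeroʳ (+ suc m))))
    (λ (t , v≢0) → t , λ mv≡0 → [ (λ ()) , v≢0 ] (ℤP.i*j≡0⇒i≡0∨j≡0 (+ suc m) mv≡0))

below-multiple : ∀ {n} M .{{_ : ℚ.Positive M}} {x x′ y′ : ℚⁿ n} → (∀ i → x′ i ≡ M * y′ i) →
                 (∀ i → 0ℚ ≤ x i) → (∀ i → x i ≤ x′ i) →
                 Σ (ℚⁿ n) λ y → (∀ i → 0ℚ ≤ y i) × (∀ i → y i ≤ y′ i) × (∀ i → x i ≡ M * y i)
below-multiple M {x} {y′ = y′} x′≡My′ x≥0 x≤x′ = y , y≥0 , y≤y′ , sym ∘ My≡x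
  where
  instance
    M-nonZero : ℚ.NonZero M
    M-nonZero = ℚP.pos⇒nonZero M

  y : ℚⁿ _
  y i = x i * 1/ M

  My≡x : ∀ i → M * y i ≡ x i
  My≡x i = trans (solve 3 (λ M x M⁻¹ → M :* (x :* M⁻¹) := x :* (M :* M⁻¹)) refl M (x i) (1/ M))
    (trans (cong (x i *_) (ℚP.*-inverseʳ M)) (ℚP.*-identityʳ (x i)))

  y≥0 : ∀ i → 0ℚ ≤ y i
  y≥0 i = ℚP.*-cancelˡ-≤-pos M (subst₂ _≤_ (sym (ℚP.*-zeroʳ M)) (sym (My≡x i)) (x≥0 i))

  y≤y′ : ∀ i → y i ≤ y′ i
  y≤y′ i = ℚP.*-cancelˡ-≤-pos M (subst₂ _≤_ (sym (My≡x i)) (x′≡My′ i) (x≤x′ i))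

dilate-antiblocking : ∀ {n} (Q : LatticePolytope n) → Antiblocking Q → ∀ m → Antiblocking (m ·P Q)
dilate-antiblocking Q (nonneg , downward) m = nonneg′ , downward′ m
  where
  -- `case`, not `with`: with-abstraction would normalise the rationals ι (+ c) * y i.
  nonneg′ : ∀ x → x ∈P (m ·P Q) → ∀ i → 0ℚ ≤ x i
  nonneg′ x x∈mQ i = case ∈·P⁻ Q m x∈mQ of λ (y , y∈Q , x≡my) →
    subst₂ _≤_ (ℚP.*-zeroʳ (ι (+ m))) (sym (x≡my i))
      (ℚP.*-monoˡ-≤-nonNeg (ι (+ m)) {{ℚ.nonNegative (ι-nonneg m)}} (nonneg y y∈Q i))

  downward′ : ∀ c x x′ → (∀ i → 0ℚ ≤ x i) → (∀ i → x i ≤ x′ i) → x′ ∈P (c ·P Q) → x ∈P (c ·P Q)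
  downward′ zero x x′ x≥0 x≤x′ x′∈0Q = case ∈·P⁻ Q 0 x′∈0Q of λ (y′ , y′∈Q , x′≡0) →
    ∈·P⁺ Q 0 y′∈Q (λ i → trans
      (ℚP.≤-antisym (subst (x i ≤_) (trans (x′≡0 i) (ℚP.*-zeroˡ (y′ i))) (x≤x′ i)) (x≥0 i))
      (sym (ℚP.*-zeroˡ (y′ i))))
  downward′ (suc c) x x′ x≥0 x≤x′ x′∈cQ = case ∈·P⁻ Q (suc c) x′∈cQ of λ (y′ , y′∈Q , x′≡My′) →
    case below-multiple (ι (+ suc c)) {{ℚP.normalize-pos (suc c) 1}} x′≡My′ x≥0 x≤x′ of λ (y , y≥0 , y≤y′ , x≡My) →
    ∈·P⁺ Q (suc c) (downward y y′ y≥0 y≤y′ y′∈Q) x≡My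

-- The dimension is the size of the support

origin∷basis : ∀ {n r} → (Fin r → Fin n) → Fin (suc r) → ℚⁿ n
origin∷basis f zero = origin
origin∷basis f (suc l) = basis (f l)

origin∷basis-affInd : ∀ {n r} {f : Fin r → Fin n} → Injective _≡_ _≡_ f → AffInd (origin∷basis f)
origin∷basis-affInd {r = r} {f} f-injective c Σc≡0 coordinates≡0 = c≡0
  where
  open ≡-Reasoning

  c∘suc≡0 : ∀ l → c (suc l) ≡ 0ℚ
  c∘suc≡0 l = begin
    c (suc l)                       ≡⟨ ∑-δ (c ∘ suc) l ⟨
    ∑ (λ l′ → c (suc l′) * δ l′ l)  ≡⟨ ∑-cong (λ l′ → cong (c (suc l′) *_) (δ-injective f-injective l′ l)) ⟨
    rest                            ≡⟨ ℚP.+-identityˡ rest ⟨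
    0ℚ + rest                       ≡⟨ cong (_+ rest) (ℚP.*-zeroʳ (c zero)) ⟨
    c zero * 0ℚ + rest              ≡⟨ coordinates≡0 (f l) ⟩
    0ℚ                              ∎
    where
    rest = ∑ (λ l′ → c (suc l′) * δ (f l′) (f l))

  c≡0 : ∀ j → c j ≡ 0ℚ
  c≡0 zero = begin
    c zero                   ≡⟨ ℚP.+-identityʳ (c zero) ⟨
    c zero + 0ℚ              ≡⟨ cong (_+_ (c zero)) (trans (∑-cong c∘suc≡0) (∑-zero r)) ⟨
    c zero + ∑ (c ∘ suc)     ≡⟨ Σc≡0 ⟩
    0ℚ                       ∎
  c≡0 (suc l) = c∘suc≡0 l

-- Otherwise ∑ c = 0 together with the coordinates g l would be s + 1 linear conditions
-- with a nonzero solution c among r > s + 1 unknowns.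
affInd-in-coordinate-subspace : ∀ {n s r} (g : Fin s → Fin n) (p : Fin r → ℚⁿ n) →
  (∀ i → (∃ λ l → g l ≡ i) ⊎ (∀ j → p j i ≡ 0ℚ)) → AffInd p → r ℕ.≤ suc s
affInd-in-coordinate-subspace {s = s} {r} g p covered p-affInd = ℕP.≮⇒≥ dependent
  where
  A : Fin (suc s) → Fin r → ℚ
  A zero j = 1ℚ
  A (suc l) j = p j (g l)

  dependent : ¬ (suc s ℕ.< r)
  dependent s+1<r with underdetermined⇒kernel s+1<r A
  ... | c , (j₁ , c≢0) , rows = c≢0 (p-affInd c Σc≡0 coordinates≡0 j₁)
    where
    Σc≡0 : ∑ c ≡ 0ℚ
    Σc≡0 = trans (∑-cong (λ j → sym (ℚP.*-identityˡ (c j)))) (rows zero)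
    coordinates≡0 : ∀ i → ∑ (λ j → c j * p j i) ≡ 0ℚ
    coordinates≡0 i with covered i
    ... | inj₁ (l , refl) = trans (∑-cong (λ j → ℚP.*-comm (c j) (p j (g l)))) (rows (suc l))
    ... | inj₂ pᵢ≡0 = trans (∑-cong (λ j → trans (cong (c j *_) (pᵢ≡0 j)) (ℚP.*-zeroʳ (c j)))) (∑-zero r)

SortsSupport : ∀ {n} → Permutation′ n → ℕ → LatticePolytope n → Set
SortsSupport σ d Q = ∀ i → Support Q (σ ⟨$⟩ʳ i) ⇔ toℕ i ℕ.< d

module _ {n d} (Q : LatticePolytope n) (ab : Antiblocking Q) (dim : HasDim Q d)
         (σ : Permutation′ n) {s} (s≤n : s ℕ.≤ n) (sorted : SortsSupport σ s Q) where

  support-size≤dim : s ℕ.≤ d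
  support-size≤dim = ℕP.≮⇒≥ too-many
    where
    too-many : ¬ (d ℕ.< s)
    too-many d<s = proj₂ dim (origin∷basis f) points∈Q (origin∷basis-affInd f-injective)
      where
      d+1≤n = ℕP.≤-trans d<s s≤n

      f : Fin (suc d) → Fin n
      f l = σ ⟨$⟩ʳ inject≤ l d+1≤n

      f-injective : Injective _≡_ _≡_ f
      f-injective = FinP.inject≤-injective _ _ _ _ ∘ Injection.injective (↔⇒↣ σ)

      points∈Q : ∀ j → origin∷basis f j ∈P Q
      points∈Q zero = origin∈P Q ab (proj₁ (proj₂ (proj₁ dim)) zero)
      points∈Q (suc l) = basis∈P Q ab (Equivalence.from (sorted (inject≤ l d+1≤n))
        (subst (ℕ._< s) (sym (FinP.toℕ-inject≤ l d+1≤n)) (ℕP.<-≤-trans (FinP.toℕ<n l) d<s)))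

  dim≤support-size : d ℕ.≤ s
  dim≤support-size = ℕP.≤-pred (affInd-in-coordinate-subspace g p covered p-affInd)
    where
    p = proj₁ (proj₁ dim)
    p∈Q = proj₁ (proj₂ (proj₁ dim))
    p-affInd = proj₂ (proj₂ (proj₁ dim))

    g : Fin s → Fin n
    g l = σ ⟨$⟩ʳ inject≤ l s≤n

    covered : ∀ i → (∃ λ l → g l ≡ i) ⊎ (∀ j → p j i ≡ 0ℚ)
    covered i with toℕ (σ ⟨$⟩ˡ i) ℕ.<? s
    ... | yes i<s = inj₁ (fromℕ< i<s , trans (cong (σ ⟨$⟩ʳ_) inject≤-fromℕ<) (inverseʳ σ))
      where
      inject≤-fromℕ< : inject≤ (fromℕ< i<s) s≤n ≡ σ ⟨$⟩ˡ i
      inject≤-fromℕ< = FinP.toℕ-injective (trans (FinP.toℕ-inject≤ _ s≤n) (FinP.toℕ-fromℕ< i<s))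
    ... | no i≮s = inj₂ (λ j → ∈Aff-outside-support Q i∉S (∈P⇒∈Aff Q (p∈Q j)))
      where
      i∉S : ¬ Support Q i
      i∉S i∈S = i≮s (Equivalence.to (sorted (σ ⟨$⟩ˡ i)) (subst (Support Q) (sym (inverseʳ σ)) i∈S))

support-sortable : ∀ {n} (Q : LatticePolytope n) {d} → Antiblocking Q → HasDim Q d →
                   Σ (Permutation′ n) λ σ → SortsSupport σ d Q
support-sortable Q {d} ab dim with sort-to-front (support? Q)
... | s , s≤n , σ , sorted = σ , subst (λ s → SortsSupport σ s Q) s≡d sorted
  where
  s≡d : s ≡ d
  s≡d = ℕP.≤-antisym (support-size≤dim Q ab dim σ s≤n sorted) (dim≤support-size Q ab dim σ s≤n sorted)

latticePts-shifted : ∀ {n} (Q : LatticePolytope n) → Antiblocking Q → Shifted (LatticePts Q)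
latticePts-shifted Q (nonneg , downward) =
  (λ z z∈Q i → ι-cancel-≤ (nonneg (toℚⁿ z) z∈Q i)) ,
  (λ z z′ z≥0 z≤z′ → downward (toℚⁿ z) (toℚⁿ z′) (ι-mono-≤ ∘ z≥0) (ι-mono-≤ ∘ z≤z′))

𝟙-< : ∀ {n} d (i : Fin n) → toℕ i ℕ.< d → 𝟙 d i ≡ + 1
𝟙-< d i i<d rewrite Equivalence.to T-≡ (ℕP.<⇒<ᵇ i<d) = refl

𝟙-≥ : ∀ {n} d (i : Fin n) → d ℕ.≤ toℕ i → 𝟙 d i ≡ + 0
𝟙-≥ d i d≤i with toℕ i <ᵇ d in i<ᵇd
... | false = refl
... | true = contradiction (ℕP.<ᵇ⇒< (toℕ i) d (Equivalence.from T-≡ i<ᵇd)) (ℕP.≤⇒≯ d≤i)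

𝟙-nonneg : ∀ {n} d (i : Fin n) → + 0 ℤ.≤ 𝟙 d i
𝟙-nonneg d i with toℕ i <ᵇ d
... | true = ℤ.+≤+ z≤n
... | false = ℤ.+≤+ z≤n

module _ {n d} (Q : LatticePolytope n) (σ : Permutation′ n) (ab : Antiblocking Q) (sorted : SortsSupport σ d Q) where

  𝟙≤interior : ∀ {z} → IntLatticePts Q z → ∀ i → 𝟙 d i ℤ.≤ z (σ ⟨$⟩ʳ i)
  𝟙≤interior {z} z∈int i with toℕ i ℕ.<? d
  ... | yes i<d rewrite 𝟙-< d i i<d =
    ℤP.i<j⇒suc[i]≤j (ι-cancel-< {+ 0} (∈int⇒positive Q ab {toℚⁿ z} z∈int (Equivalence.from (sorted i) i<d)))
  ... | no i≮d rewrite 𝟙-≥ d i (ℕP.≮⇒≥ i≮d) = ι-cancel-≤ (proj₁ ab _ (proj₁ z∈int) (σ ⟨$⟩ʳ i))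

  shiftedInterior-shifted : Shifted (ShiftedInterior σ d Q)
  shiftedInterior-shifted = nonneg , downward
    where
    nonneg : ∀ w → ShiftedInterior σ d Q w → ∀ i → + 0 ℤ.≤ w i
    nonneg w (z , z∈int , w≡z-𝟙) i = subst (+ 0 ℤ.≤_) (sym (w≡z-𝟙 i)) (ℤP.i≤j⇒0≤j-i (𝟙≤interior {z} z∈int i))

    downward : ∀ w w′ → (∀ i → + 0 ℤ.≤ w i) → (∀ i → w i ℤ.≤ w′ i) →
               ShiftedInterior σ d Q w′ → ShiftedInterior σ d Q w
    downward w w′ w≥0 w≤w′ (z′ , z′∈int , w′≡z′-𝟙) = z , z∈int , w≡z-𝟙
      where
      σ⁻¹ : Fin n → Fin n
      σ⁻¹ j = σ ⟨$⟩ˡ j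

      z : ℤⁿ n
      z j = w (σ⁻¹ j) ℤ.+ 𝟙 d (σ⁻¹ j)

      w≡z-𝟙 : ∀ i → w i ≡ z (σ ⟨$⟩ʳ i) ℤ.- 𝟙 d i
      w≡z-𝟙 i = sym (trans (cong (λ j → (w j ℤ.+ 𝟙 d j) ℤ.- 𝟙 d i) (inverseˡ σ)) (i+j-j≡i (w i) (𝟙 d i)))

      z′≡w′+𝟙 : ∀ j → z′ j ≡ w′ (σ⁻¹ j) ℤ.+ 𝟙 d (σ⁻¹ j)
      z′≡w′+𝟙 j = begin
        z′ j                                        ≡⟨ cong z′ (inverseʳ σ) ⟨
        z′ (σ ⟨$⟩ʳ σ⁻¹ j)                           ≡⟨ i-j+j≡i (z′ (σ ⟨$⟩ʳ σ⁻¹ j)) (𝟙 d (σ⁻¹ j)) ⟨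
        (z′ (σ ⟨$⟩ʳ σ⁻¹ j) ℤ.- 𝟙 d (σ⁻¹ j)) ℤ.+ 𝟙 d (σ⁻¹ j) ≡⟨ cong (ℤ._+ 𝟙 d (σ⁻¹ j)) (w′≡z′-𝟙 (σ⁻¹ j)) ⟨
        w′ (σ⁻¹ j) ℤ.+ 𝟙 d (σ⁻¹ j)                  ∎
        where open ≡-Reasoning

      z≥1 : ∀ j → Support Q j → 1ℚ ≤ toℚⁿ z j
      z≥1 j j∈S = ι-mono-≤ (subst (λ u → + 1 ℤ.≤ w (σ⁻¹ j) ℤ.+ u) (sym (𝟙-< d (σ⁻¹ j) σ⁻¹j<d))
                                 (ℤP.+-monoˡ-≤ (+ 1) (w≥0 (σ⁻¹ j))))
        where
        σ⁻¹j<d = Equivalence.to (sorted (σ⁻¹ j)) (subst (Support Q) (sym (inverseʳ σ)) j∈S)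

      z∈int : IntLatticePts Q z
      z∈int = ∈int-downward Q ab z′∈int
        (λ j → ι-mono-≤ (ℤP.+-mono-≤ (w≥0 (σ⁻¹ j)) (𝟙-nonneg d (σ⁻¹ j))))
        (λ j → ι-mono-≤ (subst (z j ℤ.≤_) (sym (z′≡w′+𝟙 j)) (ℤP.+-monoˡ-≤ (𝟙 d (σ⁻¹ j)) (w≤w′ (σ⁻¹ j)))))
        z≥1

proposition3p13 : ∀ (n d : ℕ) (P : LatticePolytope n) →
    Antiblocking P → HasDim P d →
    (Shifted (LatticePts P) × (∀ (m : ℕ) → Shifted (LatticePts (m ·P P)))) ×
    Σ (Permutation′ n) (λ σ →
    Shifted (ShiftedInterior σ d P) ×
    (∀ (m : ℕ) → m ≥ 1 → Shifted (ShiftedInterior σ d (m ·P P))))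
proposition3p13 n d P ab dim =
  (latticePts-shifted P ab , λ m → latticePts-shifted (m ·P P) (dilate-antiblocking P ab m)) ,
  σ , shiftedInterior-shifted P σ ab sorted , dilates
  where
  σ : Permutation′ n
  σ = proj₁ (support-sortable P ab dim)

  sorted : SortsSupport σ d P
  sorted = proj₂ (support-sortable P ab dim)

  dilates : ∀ m → m ≥ 1 → Shifted (ShiftedInterior σ d (m ·P P))
  dilates (suc m) _ = shiftedInterior-shifted (suc m ·P P) σ (dilate-antiblocking P ab (suc m))
    (λ i → ⇔.trans (Support-·P P m) (sorted i))
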